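{- Let $G$ be a subgroup of $S_6$ (the Lunn–Senior group of substitution isomerism of an organic compound consisting of a skeleton with six univalent substituents) such that $n_{(5,1);G}=1$ and $n_{(4,2);G}\geq 3$, and suppose $|G|=6$. If $G$ is cyclic, then $n_{(4,2);G}=3$, $n_{(4,1,1);G}\leq 5$ and $n_{(3,3);G}\leq 4$. If $G$ is dihedral, then $n_{(4,2);G}\in\{3,4\}$, $n_{(4,1,1);G}\leq 5$ and $n_{(3,3);G}\leq 4$. (That is: exactly three, resp. three or four, di-substitution homogeneous derivatives, at most five di-substitution heterogeneous derivatives, and at most four tri-substitution homogeneous derivatives.)
   Context: For a partition $\lambda=(\lambda_1,\dots,\lambda_6)$ of $6$ (with $\lambda_1\geq\cdots\geq\lambda_6\geq 0$, $\sum\lambda_k=6$), a tabloid of shape $\lambda$ is an ordered tuple $(A_1,\dots,A_6)$ of pairwise disjoint subsets of $\{1,\dots,6\}$ with union $\{1,\dots,6\}$ and $|A_k|=\lambda_k$ for all $k$. A subgroup $G\le S_6$ acts on tabloids of shape $\lambda$ by $\sigma(A_1,\dots,A_6)=(\sigma(A_1),\dots,\sigma(A_6))$, and $n_{\lambda;G}$ denotes the number of $G$-orbits on the set of tabloids of shape $\lambda$. Partitions are written omitting zero parts. In the chemical interpretation, orbits of shape $(5,1)$ are mono-substitution derivatives, $(4,2)$ di-substitution homogeneous, $(4,1,1)$ di-substitution heterogeneous, and $(3,3)$ tri-substitution homogeneous derivatives. -}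

module Defs where

open import Data.Nat using (ℕ; zero; suc)
open import Data.Bool using (Bool; true; false; _∧_; _∨_)
open import Data.Fin using (Fin; _≟_)
open import Data.Fin.Subset using (Subset; _∈_; _∉_; ∣_∣)
open import Data.Vec using (Vec; []; _∷_; lookup; tabulate; allFin; map; foldr)
open import Data.List using (List; length)
open import Data.List.Membership.Propositional using () renaming (_∈_ to _∈ₗ_)
open import Data.List.Relation.Unary.All using (All)
open import Data.List.Relation.Unary.Any using (Any)
open import Data.List.Relation.Unary.AllPairs using (AllPairs)
open import Data.List.Relation.Unary.Unique.Propositional using (Unique)
open import Data.Product using (Σ; ∃; _×_; _,_)
open import Relation.Binary.PropositionalEquality using (_≡_; _≢_)
open import Relation.Nullary using (¬_)
open import Relation.Nullary.Decidable using (⌊_⌋)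

-- Permutations of {1,…,6} (encoded as Fin 6), as lookup tables.
-- σ is represented by the vector (σ 0, …, σ 5).

Perm : Set
Perm = Vec (Fin 6) 6

-- a table is a permutation iff it is injective (finite set)
IsPerm : Perm → Set
IsPerm σ = ∀ i j → lookup σ i ≡ lookup σ j → i ≡ j

idPerm : Perm
idPerm = allFin 6

_∘ₚ_ : Perm → Perm → Perm
σ ∘ₚ τ = tabulate (λ i → lookup σ (lookup τ i))

_^ₚ_ : Perm → ℕ → Perm
g ^ₚ zero = idPerm
g ^ₚ suc k = g ∘ₚ (g ^ₚ k)

-- Subgroups of S₆, given as duplicate-free lists of their elements
-- (so the order |G| is the length of the list).

record IsSubgroup (G : List Perm) : Set where
  field
    perms    : All IsPerm G
    distinct : Unique G
    hasId    : idPerm ∈ₗ G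
    closed   : ∀ {σ τ} → σ ∈ₗ G → τ ∈ₗ G → (σ ∘ₚ τ) ∈ₗ G
    inverses : ∀ {σ} → σ ∈ₗ G → Σ Perm (λ τ → τ ∈ₗ G × (σ ∘ₚ τ) ≡ idPerm)

order : List Perm → ℕ
order G = length G

IsCyclic : List Perm → Set
IsCyclic G = Σ Perm (λ g → g ∈ₗ G × (∀ {h} → h ∈ₗ G → ∃ (λ k → h ≡ g ^ₚ k)))

IsDihedral : List Perm → Set
IsDihedral G = Σ Perm λ r → Σ Perm λ s →
  r ∈ₗ G × s ∈ₗ G ×
  (r ^ₚ 3) ≡ idPerm × (s ^ₚ 2) ≡ idPerm × (s ∘ₚ (r ∘ₚ s)) ≡ (r ^ₚ 2) ×
  (∀ {h} → h ∈ₗ G → Σ (Fin 3) λ i → Σ (Fin 2) λ j →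
      h ≡ ((r ^ₚ Data.Fin.toℕ i) ∘ₚ (s ^ₚ Data.Fin.toℕ j)))

Partition6 : Set
Partition6 = Vec ℕ 6

Tuple : Set
Tuple = Vec (Subset 6) 6

IsTabloid : Partition6 → Tuple → Set
IsTabloid λ' T =
  (∀ k l → k ≢ l → ∀ x → x ∈ lookup T k → x ∉ lookup T l) ×
  (∀ x → ∃ (λ k → x ∈ lookup T k)) ×
  (∀ k → ∣ lookup T k ∣ ≡ lookup λ' k)

image : Perm → Subset 6 → Subset 6
image σ A = tabulate (λ y → foldr _ _∨_ false
                         (tabulate (λ x → lookup A x ∧ ⌊ lookup σ x ≟ y ⌋)))

act : Perm → Tuple → Tuple
act σ T = map (image σ) T

SameOrbit : List Perm → Tuple → Tuple → Set
SameOrbit G T T' = Σ Perm (λ σ → σ ∈ₗ G × act σ T ≡ T')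

-- n_{λ;G} = n : there is a system of n representatives of the G-orbits on tabloids of shape λ
OrbitCount : List Perm → Partition6 → ℕ → Set
OrbitCount G λ' n = Σ (List Tuple) λ reps →
  length reps ≡ n ×
  All (IsTabloid λ') reps ×
  AllPairs (λ T T' → ¬ SameOrbit G T T') reps ×
  (∀ T → IsTabloid λ' T → Any (λ R → SameOrbit G R T) reps)

λ51 λ42 λ411 λ33 : Partition6
λ51  = 5 ∷ 1 ∷ 0 ∷ 0 ∷ 0 ∷ 0 ∷ []
λ42  = 4 ∷ 2 ∷ 0 ∷ 0 ∷ 0 ∷ 0 ∷ []
λ411 = 4 ∷ 1 ∷ 1 ∷ 0 ∷ 0 ∷ 0 ∷ []
λ33  = 3 ∷ 3 ∷ 0 ∷ 0 ∷ 0 ∷ 0 ∷ []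

-- By n_(5,1) = 1 the group G is transitive on the six positions, since its single orbit of
-- (5,1)-tabloids contains every tabloid ({1,…,6} ∖ {x}, {x}). A cyclic or dihedral G is then
-- regular: fixing a base point q and labelling the point h q by h identifies the action of G
-- on positions with the action of C₆ resp. D₃ on itself by left multiplication. In these labels
-- an exhaustive check shows that every tabloid of shape (4,2), (4,1,1), (3,3) lies in the orbit
-- of one of 3, 5, 4 (cyclic) resp. 4, 5, 4 (dihedral) listed tabloids, and by pigeonhole no list
-- of pairwise inequivalent tabloids is longer; with n_(4,2) ≥ 3 this is the claim.

module Submission where

open import Defs
open import Data.Bool as Bool using (Bool; true; false; _∧_; _∨_; if_then_else_)
open import Data.Bool.ListAction using (any)
open import Data.Bool.Properties using (∨-identityʳ; ∧-zeroʳ; ∧-identityʳ)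
open import Data.Fin as Fin using (Fin; zero; suc; #_; toℕ; fromℕ<; punchOut; combine; remQuot)
open import Data.Fin.Permutation using (permutation)
open import Data.Fin.Properties
  using (pigeonhole; injective⇒≤; punchOut-injective; suc-injective; any?; all?; toℕ<n; toℕ-fromℕ<; remQuot-combine)
open import Data.Fin.Subset using (Subset; inside; outside; _∈_; ∣_∣; ⁅_⁆; ∁) renaming (⊥ to ∅)
open import Data.Fin.Subset.Properties using (_∈?_; x∈⁅x⁆; x∈⁅y⁆⇒x≡y)
open import Data.List using (List; []; _∷_; [_]; length; filter; concatMap; _++_)
import Data.List as List
open import Data.List.Membership.Propositional using () renaming (_∈_ to _∈ₗ_)
open import Data.List.Membership.Propositional.Properties
  using (∈-lookup; ∈-map⁺; ∈-++⁺ˡ; ∈-++⁺ʳ; ∈-filter⁺; ∈-concatMap⁺)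
open import Data.List.Relation.Unary.All as All using (All; []; _∷_)
open import Data.List.Relation.Unary.AllPairs using (AllPairs; []; _∷_)
open import Data.List.Relation.Unary.Any as Any using (Any; here)
open import Data.Nat as ℕ using (ℕ; zero; suc; _≤_; _<_; _+_; _*_; _^_; _∸_; _%_; _/_; _≡ᵇ_; s≤s; NonZero; >-nonZero)
open import Data.Nat.DivMod using (m≡m%n+[m/n]*n; m%n<n)
open import Data.Nat.GeneralisedArithmetic using (fold; fold-+)
open import Data.Nat.Properties
  using (≤-antisym; ≤-trans; ≤-pred; <⇒≤; n<1+n; 1+n≰n; _≤?_; ≰⇒>; m∸n≤m; m<n⇒0<n∸m; m+[n∸m]≡n;
         *-assoc; *-comm; *-suc; *-identityʳ; +-0-commutativeMonoid)
open import Data.Product using (Σ; ∃; ∃₂; _×_; _,_; proj₁; proj₂)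
open import Data.Sum using (_⊎_; inj₁; inj₂)
open import Data.Vec using (Vec; []; _∷_; lookup; tabulate; map; foldr)
open import Data.Vec.Properties
  using (lookup∘tabulate; lookup-allFin; tabulate-cong; map-cong; map-∘; map-id; tabulate∘lookup; lookup-map;
         []=⇒lookup; lookup⇒[]=)
  renaming (≡-dec to ≡-decᵥ)
open import Algebra.Properties.CommutativeMonoid.Sum +-0-commutativeMonoid using (sum; sum-permute; sum-cong-≗)
open import Function using (_∘_; id)
open import Function.Definitions using (Injective)
open import Relation.Binary.PropositionalEquality
  using (_≡_; _≢_; refl; sym; trans; cong; cong₂; subst; module ≡-Reasoning)
open import Relation.Nullary using (¬_; Dec; yes; no; contradiction)
open import Relation.Nullary.Decidable
  using (⌊_⌋; from-yes; dec-true; dec-false; isYes≗does; map′; _×-dec_; _→-dec_; ¬?)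

private
  variable
    A : Set
    k m n : ℕ

-- Maps between finite sets

surjective⇒≤ : (f : Fin m → Fin n) → (∀ y → ∃ λ x → f x ≡ y) → n ≤ m
surjective⇒≤ f surj = injective⇒≤ {f = proj₁ ∘ surj} λ {y} {y′} e →
  trans (sym (proj₂ (surj y))) (trans (cong f e) (proj₂ (surj y′)))

injective⇒surjective : {f : Fin n → Fin n} → Injective _≡_ _≡_ f → ∀ y → ∃ λ x → f x ≡ y
injective⇒surjective {suc n} {f} f-inj y with any? (λ x → f x Fin.≟ y)
... | yes hit  = hit
... | no  miss = contradiction (injective⇒≤ punched-injective) 1+n≰n
  where
  punched : Fin (suc n) → Fin n
  punched x = punchOut {i = y} λ e → miss (x , sym e)
  punched-injective : Injective _≡_ _≡_ punched
  punched-injective {x} {x′} e = f-inj (punchOut-injective {i = y} (λ e → miss (x , sym e)) (λ e → miss (x′ , sym e)) e)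

rightInverse⇒injective : {f : A → A} {g : A → A} → (∀ y → f (g y) ≡ y) → Injective _≡_ _≡_ g
rightInverse⇒injective {f = f} f∘g≗id {a} {b} e = trans (sym (f∘g≗id a)) (trans (cong f e) (f∘g≗id b))

rightInverse⇒leftInverse : {f g : Fin n → Fin n} → (∀ y → f (g y) ≡ y) → ∀ x → g (f x) ≡ x
rightInverse⇒leftInverse {f = f} {g} f∘g≗id x
  with y , refl ← injective⇒surjective {f = g} (rightInverse⇒injective {f = f} f∘g≗id) x = cong g (f∘g≗id y)

module _ {P : A → Set} {S : A → A → Set} where

  AllPairs-lookup : ∀ {xs} → AllPairs S xs → ∀ {i j} → i Fin.< j → S (List.lookup xs i) (List.lookup xs j)
  AllPairs-lookup (Sx ∷ Sxs) {zero}  {suc j} _         = All.lookup Sx (∈-lookup j)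
  AllPairs-lookup (Sx ∷ Sxs) {suc i} {suc j} (s≤s i<j) = AllPairs-lookup Sxs i<j

  length≤classes : (class : ∀ {x} → P x → Fin m) →
                   (∀ {x y} (px : P x) (py : P y) → class px ≡ class py → ¬ S x y) →
                   ∀ {xs} → All P xs → AllPairs S xs → length xs ≤ m
  length≤classes {m} class same {xs} pxs Sxs with length xs ≤? m
  ... | yes ≤m = ≤m
  ... | no  ≰m with i , j , i<j , eq ← pigeonhole (≰⇒> ≰m) (λ u → class (All.lookup pxs (∈-lookup u))) =
    contradiction (AllPairs-lookup Sxs i<j) (same _ _ eq)

-- Iterates of a permutation

⟦_⟧ : Perm → Fin 6 → Fin 6
⟦_⟧ = lookup

⟦∘ₚ⟧ : ∀ σ τ x → ⟦ σ ∘ₚ τ ⟧ x ≡ ⟦ σ ⟧ (⟦ τ ⟧ x)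
⟦∘ₚ⟧ σ τ = lookup∘tabulate (λ i → ⟦ σ ⟧ (⟦ τ ⟧ i))

⟦^ₚ⟧ : ∀ g k x → ⟦ g ^ₚ k ⟧ x ≡ fold x ⟦ g ⟧ k
⟦^ₚ⟧ g zero    x = lookup-allFin x
⟦^ₚ⟧ g (suc k) x = trans (⟦∘ₚ⟧ g (g ^ₚ k) x) (cong ⟦ g ⟧ (⟦^ₚ⟧ g k x))

⟦idPerm⟧ : ∀ x → ⟦ idPerm ⟧ x ≡ x
⟦idPerm⟧ = ⟦^ₚ⟧ idPerm 0

module _ {f : A → A} {q : A} where

  fold-periodic : fold q f n ≡ q → ∀ t → fold q f (t * n) ≡ q
  fold-periodic         fⁿq≡q zero    = refl
  fold-periodic {n = n} fⁿq≡q (suc t) = begin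
    fold q f (n + t * n)        ≡⟨ fold-+ q f n ⟩
    fold (fold q f (t * n)) f n ≡⟨ cong (λ z → fold z f n) (fold-periodic fⁿq≡q t) ⟩
    fold q f n                  ≡⟨ fⁿq≡q ⟩
    q                           ∎
    where open ≡-Reasoning

  fold-% : ∀ n .{{_ : NonZero n}} → fold q f n ≡ q → ∀ k → fold q f k ≡ fold q f (k % n)
  fold-% n fⁿq≡q k = begin
    fold q f k                                ≡⟨ cong (fold q f) (m≡m%n+[m/n]*n k n) ⟩
    fold q f (k % n + (k / n) * n)            ≡⟨ fold-+ q f (k % n) ⟩
    fold (fold q f ((k / n) * n)) f (k % n)   ≡⟨ cong (λ z → fold z f (k % n)) (fold-periodic fⁿq≡q (k / n)) ⟩
    fold q f (k % n)                          ∎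
    where open ≡-Reasoning

fold-injective : {f : A → A} → Injective _≡_ _≡_ f → ∀ k → Injective _≡_ _≡_ (λ x → fold x f k)
fold-injective f-inj zero    = id
fold-injective f-inj (suc k) = fold-injective f-inj k ∘ f-inj

module _ {f : Fin n → Fin n} {q : Fin n} where

  orbit-mod : ∀ .{{_ : NonZero k}} → fold q f k ≡ q → (∀ y → ∃ λ j → fold q f j ≡ y) →
              ∀ y → ∃ λ (u : Fin k) → fold q f (toℕ u) ≡ y
  orbit-mod {k} fᵏq≡q orbit y with j , fʲq≡y ← orbit y =
    fromℕ< (m%n<n j k) , (begin
      fold q f (toℕ (fromℕ< (m%n<n j k))) ≡⟨ cong (fold q f) (toℕ-fromℕ< (m%n<n j k)) ⟩
      fold q f (j % k)                    ≡⟨ fold-% k fᵏq≡q j ⟨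
      fold q f j                          ≡⟨ fʲq≡y ⟩
      y                                   ∎)
    where open ≡-Reasoning

  return-time : Injective _≡_ _≡_ f → ∃ λ d → 0 < d × d ≤ n × fold q f d ≡ q
  return-time f-inj
    with i , j , i<j , fⁱq≡fʲq ← pigeonhole (n<1+n n) (λ (u : Fin (suc n)) → fold q f (toℕ u)) =
    toℕ j ∸ toℕ i , m<n⇒0<n∸m i<j , ≤-trans (m∸n≤m (toℕ j) (toℕ i)) (≤-pred (toℕ<n j)) ,
    fold-injective f-inj (toℕ i) (begin
      fold (fold q f (toℕ j ∸ toℕ i)) f (toℕ i) ≡⟨ fold-+ q f (toℕ i) ⟨
      fold q f (toℕ i + (toℕ j ∸ toℕ i))        ≡⟨ cong (fold q f) (m+[n∸m]≡n (<⇒≤ i<j)) ⟩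
      fold q f (toℕ j)                          ≡⟨ fⁱq≡fʲq ⟨
      fold q f (toℕ i)                          ∎)
    where open ≡-Reasoning

  orbit-period : Injective _≡_ _≡_ f → (∀ y → ∃ λ j → fold q f j ≡ y) → fold q f n ≡ q
  orbit-period f-inj orbit with d , 0<d , d≤n , fᵈq≡q ← return-time f-inj =
    subst (λ e → fold q f e ≡ q) (≤-antisym d≤n n≤d) fᵈq≡q
    where
    instance
      d≢0 : NonZero d
      d≢0 = >-nonZero 0<d
    n≤d : n ≤ d
    n≤d = surjective⇒≤ (λ u → fold q f (toℕ u)) (orbit-mod fᵈq≡q orbit)

-- Preimages and tabloids

preimage : (Fin n → Fin n) → Vec (Subset n) k → Vec (Subset n) k
preimage f = map (λ A → tabulate (lookup A ∘ f))

lookup-preimage : ∀ (f : Fin n → Fin n) (T : Vec (Subset n) k) i x →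
                  lookup (lookup (preimage f T) i) x ≡ lookup (lookup T i) (f x)
lookup-preimage f T i x =
  trans (cong (λ A → lookup A x) (lookup-map i _ T)) (lookup∘tabulate (lookup (lookup T i) ∘ f) x)

∈-preimage⁺ : ∀ (f : Fin n → Fin n) (T : Vec (Subset n) k) {i x} → f x ∈ lookup T i → x ∈ lookup (preimage f T) i
∈-preimage⁺ f T {i} {x} fx∈ = lookup⇒[]= x _ (trans (lookup-preimage f T i x) ([]=⇒lookup fx∈))

∈-preimage⁻ : ∀ (f : Fin n → Fin n) (T : Vec (Subset n) k) {i x} → x ∈ lookup (preimage f T) i → f x ∈ lookup T i
∈-preimage⁻ f T {i} {x} x∈ = lookup⇒[]= (f x) _ (trans (sym (lookup-preimage f T i x)) ([]=⇒lookup x∈))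

preimage-cong : ∀ {f g : Fin n → Fin n} → (∀ x → f x ≡ g x) → (T : Vec (Subset n) k) → preimage f T ≡ preimage g T
preimage-cong f≗g = map-cong (λ A → tabulate-cong (cong (lookup A) ∘ f≗g))

preimage-∘ : ∀ (f g : Fin n → Fin n) (T : Vec (Subset n) k) → preimage f (preimage g T) ≡ preimage (g ∘ f) T
preimage-∘ f g T = trans (sym (map-∘ _ _ T))
  (map-cong (λ A → tabulate-cong (lookup∘tabulate (lookup A ∘ g) ∘ f)) T)

preimage-id : (T : Vec (Subset n) k) → preimage id T ≡ T
preimage-id T = trans (map-cong tabulate∘lookup T) (map-id T)

indicator : Bool → ℕ
indicator b = if b then 1 else 0

∣p∣≡∑ : (p : Subset n) → ∣ p ∣ ≡ sum (indicator ∘ lookup p)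
∣p∣≡∑ []            = refl
∣p∣≡∑ (true  ∷ p) = cong suc (∣p∣≡∑ p)
∣p∣≡∑ (false ∷ p) = ∣p∣≡∑ p

∣preimage∣ : ∀ {f g : Fin n → Fin n} → (∀ y → f (g y) ≡ y) → (∀ x → g (f x) ≡ x) →
             (p : Subset n) → ∣ tabulate (lookup p ∘ f) ∣ ≡ ∣ p ∣
∣preimage∣ {f = f} {g} f∘g≗id g∘f≗id p = begin
  ∣ tabulate (lookup p ∘ f) ∣                           ≡⟨ ∣p∣≡∑ (tabulate (lookup p ∘ f)) ⟩
  sum (indicator ∘ lookup (tabulate (lookup p ∘ f)))    ≡⟨ sum-cong-≗ (cong indicator ∘ lookup∘tabulate (lookup p ∘ f)) ⟩
  sum (indicator ∘ lookup p ∘ f)                        ≡⟨ sum-permute (indicator ∘ lookup p) (permutation f g f∘g≗id g∘f≗id) ⟨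
  sum (indicator ∘ lookup p)                            ≡⟨ ∣p∣≡∑ p ⟨
  ∣ p ∣                                                 ∎
  where open ≡-Reasoning

preimage-tabloid : ∀ {f g : Fin 6 → Fin 6} → (∀ y → f (g y) ≡ y) → (∀ x → g (f x) ≡ x) →
                   ∀ λ′ R → IsTabloid λ′ R → IsTabloid λ′ (preimage f R)
preimage-tabloid {f} f∘g≗id g∘f≗id λ′ R (disjoint , covering , sizes) =
  (λ i j i≢j x x∈i x∈j → disjoint i j i≢j (f x) (∈-preimage⁻ f R x∈i) (∈-preimage⁻ f R x∈j)) ,
  (λ x → proj₁ (covering (f x)) , ∈-preimage⁺ f R (proj₂ (covering (f x)))) ,
  (λ i → trans (cong ∣_∣ (lookup-map i _ R)) (trans (∣preimage∣ {f = f} f∘g≗id g∘f≗id (lookup R i)) (sizes i)))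

foldr-∨-single : (b : Fin n → Bool) (i : Fin n) → (∀ j → j ≢ i → b j ≡ false) →
                 foldr _ _∨_ false (tabulate b) ≡ b i
foldr-∨-single b zero    b≡false =
  trans (cong (b zero ∨_) (none (b ∘ suc) (λ j → b≡false (suc j) λ ()))) (∨-identityʳ (b zero))
  where
  none : (c : Fin m → Bool) → (∀ j → c j ≡ false) → foldr _ _∨_ false (tabulate c) ≡ false
  none {zero}  c c≡false = refl
  none {suc m} c c≡false rewrite c≡false zero = none (c ∘ suc) (c≡false ∘ suc)
foldr-∨-single b (suc i) b≡false rewrite b≡false zero (λ ()) =
  foldr-∨-single (b ∘ suc) i (λ j j≢i → b≡false (suc j) (j≢i ∘ suc-injective))

image≡preimage : ∀ σ {ρ : Fin 6 → Fin 6} → IsPerm σ → (∀ y → ⟦ σ ⟧ (ρ y) ≡ y) →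
                 ∀ A → image σ A ≡ tabulate (lookup A ∘ ρ)
image≡preimage σ {ρ} σ-inj σ∘ρ≗id A = tabulate-cong λ y → begin
  foldr _ _∨_ false (tabulate λ x → lookup A x ∧ ⌊ ⟦ σ ⟧ x Fin.≟ y ⌋) ≡⟨ foldr-∨-single _ (ρ y) (others y) ⟩
  lookup A (ρ y) ∧ ⌊ ⟦ σ ⟧ (ρ y) Fin.≟ y ⌋                           ≡⟨ cong (lookup A (ρ y) ∧_) (hit y) ⟩
  lookup A (ρ y) ∧ true                                               ≡⟨ ∧-identityʳ (lookup A (ρ y)) ⟩
  lookup A (ρ y)                                                      ∎
  where
  open ≡-Reasoning
  hit : ∀ y → ⌊ ⟦ σ ⟧ (ρ y) Fin.≟ y ⌋ ≡ true
  hit y = trans (isYes≗does (⟦ σ ⟧ (ρ y) Fin.≟ y)) (dec-true (⟦ σ ⟧ (ρ y) Fin.≟ y) (σ∘ρ≗id y))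
  miss : ∀ y x → x ≢ ρ y → ⌊ ⟦ σ ⟧ x Fin.≟ y ⌋ ≡ false
  miss y x x≢ρy = trans (isYes≗does (⟦ σ ⟧ x Fin.≟ y))
    (dec-false (⟦ σ ⟧ x Fin.≟ y) λ σx≡y → x≢ρy (σ-inj x (ρ y) (trans σx≡y (sym (σ∘ρ≗id y)))))
  others : ∀ y x → x ≢ ρ y → lookup A x ∧ ⌊ ⟦ σ ⟧ x Fin.≟ y ⌋ ≡ false
  others y x x≢ρy = trans (cong (lookup A x ∧_) (miss y x x≢ρy)) (∧-zeroʳ (lookup A x))

act≡preimage : ∀ σ {ρ : Fin 6 → Fin 6} → IsPerm σ → (∀ y → ⟦ σ ⟧ (ρ y) ≡ y) →
               ∀ T → act σ T ≡ preimage ρ T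
act≡preimage σ σ-inj σ∘ρ≗id = map-cong (image≡preimage σ σ-inj σ∘ρ≗id)

subsets : ∀ n → List (Subset n)
subsets zero    = [ [] ]
subsets (suc n) = List.map (inside ∷_) (subsets n) ++ List.map (outside ∷_) (subsets n)

∈-subsets : (p : Subset n) → p ∈ₗ subsets n
∈-subsets []                  = here refl
∈-subsets {suc n} (true  ∷ p) = ∈-++⁺ˡ (∈-map⁺ (inside ∷_) (∈-subsets p))
∈-subsets {suc n} (false ∷ p) = ∈-++⁺ʳ (List.map (inside ∷_) (subsets n)) (∈-map⁺ (outside ∷_) (∈-subsets p))

choices : Vec (List A) k → List (Vec A k)
choices []         = [ [] ]
choices (xs ∷ xss) = concatMap (λ x → List.map (x ∷_) (choices xss)) xs

∈-choices : (xss : Vec (List A) k) {v : Vec A k} → (∀ i → lookup v i ∈ₗ lookup xss i) → v ∈ₗ choices xss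
∈-choices []         {[]}    _  = here refl
∈-choices (xs ∷ xss) {x ∷ v} v∈ = ∈-concatMap⁺ (λ y → List.map (y ∷_) (choices xss)) {xs = xs}
  (Any.map (λ { refl → ∈-map⁺ (x ∷_) (∈-choices xss (v∈ ∘ suc)) }) (v∈ zero))

subsetsOfSize : ℕ → List (Subset n)
subsetsOfSize k = filter (λ p → ∣ p ∣ ℕ.≟ k) (subsets _)

∈-subsetsOfSize : (p : Subset n) → p ∈ₗ subsetsOfSize ∣ p ∣
∈-subsetsOfSize p = ∈-filter⁺ (λ p′ → ∣ p′ ∣ ℕ.≟ ∣ p ∣) (∈-subsets p) refl

shaped : Partition6 → List Tuple
shaped λ′ = choices (map subsetsOfSize λ′)

∈-shaped : ∀ λ′ T → (∀ i → ∣ lookup T i ∣ ≡ lookup λ′ i) → T ∈ₗ shaped λ′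
∈-shaped λ′ T sizes = ∈-choices (map subsetsOfSize λ′) λ i →
  subst (lookup T i ∈ₗ_) (trans (cong subsetsOfSize (sizes i)) (sym (lookup-map i subsetsOfSize λ′)))
        (∈-subsetsOfSize (lookup T i))

IsTabloid? : ∀ λ′ T → Dec (IsTabloid λ′ T)
IsTabloid? λ′ T =
  (all? λ i → all? λ j → ¬? (i Fin.≟ j) →-dec all? λ x → (x ∈? lookup T i) →-dec ¬? (x ∈? lookup T j))
  ×-dec (all? λ x → any? λ i → x ∈? lookup T i)
  ×-dec (all? λ i → ∣ lookup T i ∣ ℕ.≟ lookup λ′ i)

allTabloids? : {P : Tuple → Set} → (∀ T → Dec (P T)) → ∀ λ′ → Dec (∀ T → IsTabloid λ′ T → P T)
allTabloids? P? λ′ = map′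
  (λ all T T-tabloid → All.lookup all (∈-shaped λ′ T (proj₂ (proj₂ T-tabloid))) T-tabloid)
  (λ every → All.tabulate λ {T} _ → every T)
  (All.all? (λ T → IsTabloid? λ′ T →-dec P? T) (shaped λ′))

pointTabloid : Fin 6 → Tuple
pointTabloid q = ∁ ⁅ q ⁆ ∷ ⁅ q ⁆ ∷ ∅ ∷ ∅ ∷ ∅ ∷ ∅ ∷ []

pointTabloid-tabloid : ∀ q → IsTabloid λ51 (pointTabloid q)
pointTabloid-tabloid = from-yes (all? λ q → IsTabloid? λ51 (pointTabloid q))

tabloid51⇒pointTabloid : ∀ T → IsTabloid λ51 T → ∃ λ q → pointTabloid q ≡ T
tabloid51⇒pointTabloid = from-yes (allTabloids? (λ T → any? λ q → ≡-decᵥ (≡-decᵥ Bool._≟_) (pointTabloid q) T) λ51)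

-- Subgroups of S₆

IsTransitiveAt : List Perm → Fin 6 → Set
IsTransitiveAt G q = ∀ x → ∃ λ σ → σ ∈ₗ G × ⟦ σ ⟧ q ≡ x

module Subgroup {G : List Perm} (G-subgroup : IsSubgroup G) where
  open IsSubgroup G-subgroup

  isPerm : ∀ {σ} → σ ∈ₗ G → IsPerm σ
  isPerm = All.lookup perms

  inv : ∀ {σ} → σ ∈ₗ G → Perm
  inv σ∈G = proj₁ (inverses σ∈G)

  inv∈G : ∀ {σ} (σ∈G : σ ∈ₗ G) → inv σ∈G ∈ₗ G
  inv∈G σ∈G = proj₁ (proj₂ (inverses σ∈G))

  ⟦⟧-inverseʳ : ∀ {σ} (σ∈G : σ ∈ₗ G) y → ⟦ σ ⟧ (⟦ inv σ∈G ⟧ y) ≡ y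
  ⟦⟧-inverseʳ {σ} σ∈G y = begin
    ⟦ σ ⟧ (⟦ inv σ∈G ⟧ y) ≡⟨ ⟦∘ₚ⟧ σ (inv σ∈G) y ⟨
    ⟦ σ ∘ₚ inv σ∈G ⟧ y    ≡⟨ cong (λ τ → ⟦ τ ⟧ y) (proj₂ (proj₂ (inverses σ∈G))) ⟩
    ⟦ idPerm ⟧ y          ≡⟨ ⟦idPerm⟧ y ⟩
    y                     ∎
    where open ≡-Reasoning

  ⟦⟧-inverseˡ : ∀ {σ} (σ∈G : σ ∈ₗ G) x → ⟦ inv σ∈G ⟧ (⟦ σ ⟧ x) ≡ x
  ⟦⟧-inverseˡ {σ} σ∈G x = isPerm σ∈G _ _ (⟦⟧-inverseʳ σ∈G (⟦ σ ⟧ x))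

  ^ₚ-∈ : ∀ {g} → g ∈ₗ G → ∀ k → g ^ₚ k ∈ₗ G
  ^ₚ-∈ g∈G zero    = hasId
  ^ₚ-∈ g∈G (suc k) = closed g∈G (^ₚ-∈ g∈G k)

  act-∈ : ∀ {σ} (σ∈G : σ ∈ₗ G) T → act σ T ≡ preimage ⟦ inv σ∈G ⟧ T
  act-∈ {σ} σ∈G = act≡preimage σ (isPerm σ∈G) (⟦⟧-inverseʳ σ∈G)

  sameOrbit-via : ∀ {X R R′} → SameOrbit G X R → SameOrbit G X R′ → SameOrbit G R R′
  sameOrbit-via {X} {R} {R′} (σ , σ∈G , σX≡R) (σ′ , σ′∈G , σ′X≡R′) =
    σ′ ∘ₚ inv σ∈G , closed σ′∈G (inv∈G σ∈G) , (begin
      act (σ′ ∘ₚ inv σ∈G) R          ≡⟨ act≡preimage (σ′ ∘ₚ inv σ∈G) {ρ} (isPerm (closed σ′∈G (inv∈G σ∈G))) inverseʳ R ⟩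
      preimage ρ R                   ≡⟨ cong (preimage ρ) (trans (sym σX≡R) (act-∈ σ∈G X)) ⟩
      preimage ρ (preimage ⟦ inv σ∈G ⟧ X) ≡⟨ preimage-∘ ρ ⟦ inv σ∈G ⟧ X ⟩
      preimage (⟦ inv σ∈G ⟧ ∘ ρ) X   ≡⟨ preimage-cong (⟦⟧-inverseˡ σ∈G ∘ ⟦ inv σ′∈G ⟧) X ⟩
      preimage ⟦ inv σ′∈G ⟧ X        ≡⟨ act-∈ σ′∈G X ⟨
      act σ′ X                       ≡⟨ σ′X≡R′ ⟩
      R′                             ∎)
    where
    open ≡-Reasoning
    ρ : Fin 6 → Fin 6
    ρ y = ⟦ σ ⟧ (⟦ inv σ′∈G ⟧ y)
    inverseʳ : ∀ y → ⟦ σ′ ∘ₚ inv σ∈G ⟧ (ρ y) ≡ y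
    inverseʳ y = trans (⟦∘ₚ⟧ σ′ (inv σ∈G) (ρ y))
                       (trans (cong ⟦ σ′ ⟧ (⟦⟧-inverseˡ σ∈G _)) (⟦⟧-inverseʳ σ′∈G y))

  orbitCount≤ : ∀ {λ′} (reps : Fin m → Tuple) →
                (∀ R → IsTabloid λ′ R → ∃ λ c → SameOrbit G (reps c) R) →
                OrbitCount G λ′ n → n ≤ m
  orbitCount≤ {λ′ = λ′} reps covers (R* , refl , R*-tabloids , R*-inequivalent , _) =
    length≤classes (λ {R} R-tabloid → proj₁ (covers R R-tabloid))
      (λ {R} {R′} R-tabloid R′-tabloid same-rep → contradiction
        (sameOrbit-via (proj₂ (covers R R-tabloid))
                       (subst (λ c → SameOrbit G (reps c) R′) (sym same-rep) (proj₂ (covers R′ R′-tabloid)))))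
      R*-tabloids R*-inequivalent

  pointTabloid-moved : ∀ {σ q x} (σ∈G : σ ∈ₗ G) → act σ (pointTabloid q) ≡ pointTabloid x → ⟦ σ ⟧ q ≡ x
  pointTabloid-moved {σ} {q} {x} σ∈G σq≡x = trans (cong ⟦ σ ⟧ (sym σ⁻¹x≡q)) (⟦⟧-inverseʳ σ∈G x)
    where
    x∈σ⁻¹⁅q⁆ : x ∈ lookup (preimage ⟦ inv σ∈G ⟧ (pointTabloid q)) (suc zero)
    x∈σ⁻¹⁅q⁆ = subst (λ T → x ∈ lookup T (suc zero)) (trans (sym σq≡x) (act-∈ σ∈G (pointTabloid q))) (x∈⁅x⁆ x)
    σ⁻¹x≡q : ⟦ inv σ∈G ⟧ x ≡ q
    σ⁻¹x≡q = x∈⁅y⁆⇒x≡y q (∈-preimage⁻ ⟦ inv σ∈G ⟧ (pointTabloid q) {i = suc zero} x∈σ⁻¹⁅q⁆)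

  orbitCount51⇒transitive : OrbitCount G λ51 1 → ∃ (IsTransitiveAt G)
  -- The classification is consumed by a helper matching on its result: a `with` on it would
  -- make Agda normalise the exhaustive check.
  orbitCount51⇒transitive (R ∷ [] , _ , R-tabloid ∷ [] , _ , covers) =
    transitiveAt (tabloid51⇒pointTabloid R R-tabloid) covers
    where
    moved : ∀ {q x} → Any (λ R′ → SameOrbit G R′ (pointTabloid x)) [ pointTabloid q ] →
            ∃ λ σ → σ ∈ₗ G × ⟦ σ ⟧ q ≡ x
    moved (here (σ , σ∈G , σq≡x)) = σ , σ∈G , pointTabloid-moved σ∈G σq≡x
    transitiveAt : ∀ {R} → ∃ (λ q → pointTabloid q ≡ R) →
                   (∀ T → IsTabloid λ51 T → Any (λ R′ → SameOrbit G R′ T) [ R ]) → ∃ (IsTransitiveAt G)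
    transitiveAt (q , refl) covers′ = q , λ x → moved (covers′ (pointTabloid x) (pointTabloid-tabloid x))

-- Regular actions of C₆ and D₃

ModelOrbit : (Fin 6 → Fin 6 → Fin 6) → (Fin m → Tuple) → Tuple → Set
ModelOrbit V D C = ∃₂ λ c i → preimage (V i) (D c) ≡ C

modelOrbit? : ∀ V (D : Fin m → Tuple) C → Dec (ModelOrbit V D C)
modelOrbit? V D C = any? λ c → any? λ i → ≡-decᵥ (≡-decᵥ Bool._≟_) (preimage (V i) (D c)) C

-- The point ⟦ E x ⟧ q gets label x; in labels, E i acts as the inverse of V i.
module RegularLabelling
  {G : List Perm} (G-subgroup : IsSubgroup G) (q : Fin 6)
  (E : Fin 6 → Perm) (E∈G : ∀ i → E i ∈ₗ G) (E-onto : ∀ y → ∃ λ x → ⟦ E x ⟧ q ≡ y)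
  (V : Fin 6 → Fin 6 → Fin 6) (E-table : ∀ i x → ⟦ E i ⟧ (⟦ E (V i x) ⟧ q) ≡ ⟦ E x ⟧ q)
  where
  open Subgroup G-subgroup

  label : Fin 6 → Fin 6
  label x = ⟦ E x ⟧ q

  unlabel : Fin 6 → Fin 6
  unlabel y = proj₁ (E-onto y)

  label∘unlabel : ∀ y → label (unlabel y) ≡ y
  label∘unlabel y = proj₂ (E-onto y)

  unlabel∘label : ∀ x → unlabel (label x) ≡ x
  unlabel∘label = rightInverse⇒leftInverse {f = label} label∘unlabel

  unlabel∘E⁻¹ : ∀ i y → unlabel (⟦ inv (E∈G i) ⟧ y) ≡ V i (unlabel y)
  unlabel∘E⁻¹ i y = begin
    unlabel (E⁻¹ y)                                   ≡⟨ cong (unlabel ∘ E⁻¹) (label∘unlabel y) ⟨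
    unlabel (E⁻¹ (label (unlabel y)))                 ≡⟨ cong (unlabel ∘ E⁻¹) (E-table i (unlabel y)) ⟨
    unlabel (E⁻¹ (⟦ E i ⟧ (label (V i (unlabel y))))) ≡⟨ cong unlabel (⟦⟧-inverseˡ (E∈G i) _) ⟩
    unlabel (label (V i (unlabel y)))                 ≡⟨ unlabel∘label _ ⟩
    V i (unlabel y)                                   ∎
    where
    open ≡-Reasoning
    E⁻¹ : Fin 6 → Fin 6
    E⁻¹ = ⟦ inv (E∈G i) ⟧

  act-E : ∀ i D → act (E i) (preimage unlabel D) ≡ preimage unlabel (preimage (V i) D)
  act-E i D = begin
    act (E i) (preimage unlabel D)                ≡⟨ act-∈ (E∈G i) _ ⟩
    preimage ⟦ inv (E∈G i) ⟧ (preimage unlabel D) ≡⟨ preimage-∘ ⟦ inv (E∈G i) ⟧ unlabel D ⟩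
    preimage (unlabel ∘ ⟦ inv (E∈G i) ⟧) D        ≡⟨ preimage-cong (unlabel∘E⁻¹ i) D ⟩
    preimage (V i ∘ unlabel) D                    ≡⟨ preimage-∘ unlabel (V i) D ⟨
    preimage unlabel (preimage (V i) D)           ∎
    where open ≡-Reasoning

  modelOrbit⇒sameOrbit : ∀ (D : Fin m → Tuple) R → ModelOrbit V D (preimage label R) →
                         ∃ λ c → SameOrbit G (preimage unlabel (D c)) R
  modelOrbit⇒sameOrbit D R (c , i , eq) = c , E i , E∈G i , (begin
    act (E i) (preimage unlabel (D c))       ≡⟨ act-E i (D c) ⟩
    preimage unlabel (preimage (V i) (D c))  ≡⟨ cong (preimage unlabel) eq ⟩
    preimage unlabel (preimage label R)      ≡⟨ preimage-∘ unlabel label R ⟩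
    preimage (label ∘ unlabel) R             ≡⟨ preimage-cong label∘unlabel R ⟩
    preimage id R                            ≡⟨ preimage-id R ⟩
    R                                        ∎)
    where open ≡-Reasoning

  orbitCount≤model : ∀ λ′ (D : Fin m → Tuple) → (∀ C → IsTabloid λ′ C → ModelOrbit V D C) →
                     OrbitCount G λ′ n → n ≤ m
  orbitCount≤model λ′ D classified = orbitCount≤ {λ′ = λ′} (preimage unlabel ∘ D) λ R R-tabloid →
    modelOrbit⇒sameOrbit D R (classified (preimage label R)
      (preimage-tabloid {f = label} label∘unlabel unlabel∘label λ′ R R-tabloid))

cyclicShift : Fin 6 → Fin 6 → Fin 6
cyclicShift i x = fromℕ< (m%n<n (toℕ x + 6 ∸ toℕ i) 6)

cyclicShift-correct : ∀ i x → (toℕ i + toℕ (cyclicShift i x)) % 6 ≡ toℕ x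
cyclicShift-correct = from-yes (all? λ i → all? λ x → (toℕ i + toℕ (cyclicShift i x)) % 6 ℕ.≟ toℕ x)

module Cyclic
  {G : List Perm} (G-subgroup : IsSubgroup G) {g : Perm} (g∈G : g ∈ₗ G)
  (generates : ∀ {h} → h ∈ₗ G → ∃ λ k → h ≡ g ^ₚ k)
  {q : Fin 6} (transitive : IsTransitiveAt G q)
  where
  open Subgroup G-subgroup using (isPerm; ^ₚ-∈)

  orbit : ∀ y → ∃ λ k → fold q ⟦ g ⟧ k ≡ y
  orbit y with transitive y
  ... | σ , σ∈G , σq≡y with generates σ∈G
  ... | k , refl = k , trans (sym (⟦^ₚ⟧ g k q)) σq≡y

  period : fold q ⟦ g ⟧ 6 ≡ q
  period = orbit-period (λ {x} {y} → isPerm g∈G x y) orbit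

  rotation : Fin 6 → Perm
  rotation i = g ^ₚ toℕ i

  rotation-onto : ∀ y → ∃ λ x → ⟦ rotation x ⟧ q ≡ y
  rotation-onto y with u , gᵘq≡y ← orbit-mod period orbit y = u , trans (⟦^ₚ⟧ g (toℕ u) q) gᵘq≡y

  rotation-table : ∀ i x → ⟦ rotation i ⟧ (⟦ rotation (cyclicShift i x) ⟧ q) ≡ ⟦ rotation x ⟧ q
  rotation-table i x = begin
    ⟦ rotation i ⟧ (⟦ g ^ₚ j ⟧ q)                      ≡⟨ ⟦^ₚ⟧ g (toℕ i) (⟦ g ^ₚ j ⟧ q) ⟩
    fold (⟦ g ^ₚ j ⟧ q) ⟦ g ⟧ (toℕ i)                  ≡⟨ cong (λ y → fold y ⟦ g ⟧ (toℕ i)) (⟦^ₚ⟧ g j q) ⟩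
    fold (fold q ⟦ g ⟧ j) ⟦ g ⟧ (toℕ i)                ≡⟨ fold-+ q ⟦ g ⟧ (toℕ i) ⟨
    fold q ⟦ g ⟧ (toℕ i + j)                          ≡⟨ fold-% 6 period (toℕ i + j) ⟩
    fold q ⟦ g ⟧ ((toℕ i + j) % 6)                    ≡⟨ cong (fold q ⟦ g ⟧) (cyclicShift-correct i x) ⟩
    fold q ⟦ g ⟧ (toℕ x)                              ≡⟨ ⟦^ₚ⟧ g (toℕ x) q ⟨
    ⟦ rotation x ⟧ q                                  ∎
    where
    open ≡-Reasoning
    j : ℕ
    j = toℕ (cyclicShift i x)

  open RegularLabelling G-subgroup q rotation (^ₚ-∈ g∈G ∘ toℕ) rotation-onto cyclicShift rotation-table public

rotationExponent : Fin 6 → ℕ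
rotationExponent e = toℕ (proj₂ (remQuot {2} 3 e))

reflectionExponent : Fin 6 → ℕ
reflectionExponent e = toℕ (proj₁ (remQuot {2} 3 e))

-- Row e lists e⁻¹x in D₃, the point e standing for r^(rotationExponent e) s^(reflectionExponent e).
dihedralShift : Fin 6 → Fin 6 → Fin 6
dihedralShift e x = lookup (lookup table e) x
  where
  table : Vec (Vec (Fin 6) 6) 6
  table = (# 0 ∷ # 1 ∷ # 2 ∷ # 3 ∷ # 4 ∷ # 5 ∷ [])
        ∷ (# 2 ∷ # 0 ∷ # 1 ∷ # 5 ∷ # 3 ∷ # 4 ∷ [])
        ∷ (# 1 ∷ # 2 ∷ # 0 ∷ # 4 ∷ # 5 ∷ # 3 ∷ [])
        ∷ (# 3 ∷ # 5 ∷ # 4 ∷ # 0 ∷ # 2 ∷ # 1 ∷ [])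
        ∷ (# 4 ∷ # 3 ∷ # 5 ∷ # 1 ∷ # 0 ∷ # 2 ∷ [])
        ∷ (# 5 ∷ # 4 ∷ # 3 ∷ # 2 ∷ # 1 ∷ # 0 ∷ [])
        ∷ []

-- rⁱ sʲ · rᵏ sˡ = r^(i + k 2ʲ) s^(j + l), since s r s⁻¹ = r² = r⁻¹.
D₃Product : Fin 6 → Fin 6 → Fin 6 → Set
D₃Product e y x =
  (rotationExponent e + rotationExponent y * 2 ^ reflectionExponent e) % 3 ≡ rotationExponent x ×
  (reflectionExponent e + reflectionExponent y) % 2 ≡ reflectionExponent x

dihedralShift-correct : ∀ e x → D₃Product e (dihedralShift e x) x
dihedralShift-correct = from-yes (all? λ e → all? λ x →
  ((rotationExponent e + rotationExponent (dihedralShift e x) * 2 ^ reflectionExponent e) % 3 ℕ.≟ rotationExponent x)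
  ×-dec ((reflectionExponent e + reflectionExponent (dihedralShift e x)) % 2 ℕ.≟ reflectionExponent x))

module Dihedral
  {G : List Perm} (G-subgroup : IsSubgroup G) {r s : Perm} (r∈G : r ∈ₗ G) (s∈G : s ∈ₗ G)
  (r³≡id : r ^ₚ 3 ≡ idPerm) (s²≡id : s ^ₚ 2 ≡ idPerm) (srs≡r² : s ∘ₚ (r ∘ₚ s) ≡ r ^ₚ 2)
  (words : ∀ {h} → h ∈ₗ G → Σ (Fin 3) λ i → Σ (Fin 2) λ j → h ≡ (r ^ₚ toℕ i) ∘ₚ (s ^ₚ toℕ j))
  {q : Fin 6} (transitive : IsTransitiveAt G q)
  where
  open Subgroup G-subgroup using (^ₚ-∈)
  open IsSubgroup G-subgroup using (closed)
  open ≡-Reasoning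

  R S : Fin 6 → Fin 6
  R = ⟦ r ⟧
  S = ⟦ s ⟧

  R³ : ∀ y → fold y R 3 ≡ y
  R³ y = trans (sym (⟦^ₚ⟧ r 3 y)) (trans (cong (λ σ → ⟦ σ ⟧ y) r³≡id) (⟦idPerm⟧ y))

  S² : ∀ y → fold y S 2 ≡ y
  S² y = trans (sym (⟦^ₚ⟧ s 2 y)) (trans (cong (λ σ → ⟦ σ ⟧ y) s²≡id) (⟦idPerm⟧ y))

  SR≡R²S : ∀ y → S (R y) ≡ R (R (S y))
  SR≡R²S y = begin
    S (R y)                ≡⟨ cong (S ∘ R) (S² y) ⟨
    S (R (S (S y)))        ≡⟨ cong S (⟦∘ₚ⟧ r s (S y)) ⟨
    S (⟦ r ∘ₚ s ⟧ (S y))   ≡⟨ ⟦∘ₚ⟧ s (r ∘ₚ s) (S y) ⟨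
    ⟦ s ∘ₚ (r ∘ₚ s) ⟧ (S y) ≡⟨ cong (λ σ → ⟦ σ ⟧ (S y)) srs≡r² ⟩
    ⟦ r ^ₚ 2 ⟧ (S y)       ≡⟨ ⟦^ₚ⟧ r 2 (S y) ⟩
    R (R (S y))            ∎

  SRⁱ≡R²ⁱS : ∀ i y → S (fold y R i) ≡ fold (S y) R (2 * i)
  SRⁱ≡R²ⁱS zero    y = refl
  SRⁱ≡R²ⁱS (suc i) y = begin
    S (R (fold y R i))            ≡⟨ SR≡R²S (fold y R i) ⟩
    R (R (S (fold y R i)))        ≡⟨ cong (R ∘ R) (SRⁱ≡R²ⁱS i y) ⟩
    fold (S y) R (2 + 2 * i)      ≡⟨ cong (fold (S y) R) (*-suc 2 i) ⟨
    fold (S y) R (2 * suc i)      ∎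

  SʲRⁱ≡Rⁱ²ʲSʲ : ∀ j i y → fold (fold y R i) S j ≡ fold (fold y S j) R (i * 2 ^ j)
  SʲRⁱ≡Rⁱ²ʲSʲ zero    i y = cong (fold y R) (sym (*-identityʳ i))
  SʲRⁱ≡Rⁱ²ʲSʲ (suc j) i y = begin
    S (fold (fold y R i) S j)                    ≡⟨ cong S (SʲRⁱ≡Rⁱ²ʲSʲ j i y) ⟩
    S (fold (fold y S j) R (i * 2 ^ j))          ≡⟨ SRⁱ≡R²ⁱS (i * 2 ^ j) (fold y S j) ⟩
    fold (fold y S (suc j)) R (2 * (i * 2 ^ j))  ≡⟨ cong (fold (fold y S (suc j)) R) 2[i2ʲ]≡i2ʲ⁺¹ ⟩
    fold (fold y S (suc j)) R (i * 2 ^ suc j)    ∎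
    where
    2[i2ʲ]≡i2ʲ⁺¹ : 2 * (i * 2 ^ j) ≡ i * (2 * 2 ^ j)
    2[i2ʲ]≡i2ʲ⁺¹ = trans (sym (*-assoc 2 i (2 ^ j))) (trans (cong (_* 2 ^ j) (*-comm 2 i)) (*-assoc i 2 (2 ^ j)))

  word : ℕ → ℕ → Perm
  word i j = (r ^ₚ i) ∘ₚ (s ^ₚ j)

  ⟦word⟧ : ∀ i j y → ⟦ word i j ⟧ y ≡ fold (fold y S j) R i
  ⟦word⟧ i j y = trans (⟦∘ₚ⟧ (r ^ₚ i) (s ^ₚ j) y) (trans (⟦^ₚ⟧ r i _) (cong (λ z → fold z R i) (⟦^ₚ⟧ s j y)))

  element : Fin 6 → Perm
  element e = word (rotationExponent e) (reflectionExponent e)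

  element-onto : ∀ y → ∃ λ e → ⟦ element e ⟧ q ≡ y
  element-onto y with transitive y
  ... | σ , σ∈G , σq≡y with words σ∈G
  ... | i , j , refl = combine j i ,
    trans (cong (λ (j′ , i′) → ⟦ word (toℕ i′) (toℕ j′) ⟧ q) (remQuot-combine j i)) σq≡y

  element-table : ∀ e x → ⟦ element e ⟧ (⟦ element (dihedralShift e x) ⟧ q) ≡ ⟦ element x ⟧ q
  element-table e x = begin
    ⟦ element e ⟧ (⟦ element y ⟧ q)                               ≡⟨ ⟦word⟧ a b _ ⟩
    fold (fold (⟦ element y ⟧ q) S b) R a                         ≡⟨ cong (λ z → fold (fold z S b) R a) (⟦word⟧ i j q) ⟩
    fold (fold (fold (fold q S j) R i) S b) R a                   ≡⟨ cong (λ z → fold z R a) (SʲRⁱ≡Rⁱ²ʲSʲ b i (fold q S j)) ⟩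
    fold (fold (fold (fold q S j) S b) R (i * 2 ^ b)) R a         ≡⟨ fold-+ (fold (fold q S j) S b) R a ⟨
    fold (fold (fold q S j) S b) R (a + i * 2 ^ b)                ≡⟨ cong (λ z → fold z R (a + i * 2 ^ b)) (fold-+ q S b) ⟨
    fold (fold q S (b + j)) R (a + i * 2 ^ b)                     ≡⟨ fold-% 3 (R³ _) (a + i * 2 ^ b) ⟩
    fold (fold q S (b + j)) R ((a + i * 2 ^ b) % 3)               ≡⟨ cong (λ z → fold z R ((a + i * 2 ^ b) % 3)) (fold-% 2 (S² q) (b + j)) ⟩
    fold (fold q S ((b + j) % 2)) R ((a + i * 2 ^ b) % 3)         ≡⟨ cong₂ (λ c d → fold (fold q S d) R c) rotations reflections ⟩
    fold (fold q S (reflectionExponent x)) R (rotationExponent x) ≡⟨ ⟦word⟧ (rotationExponent x) (reflectionExponent x) q ⟨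
    ⟦ element x ⟧ q                                               ∎
    where
    y : Fin 6
    y = dihedralShift e x
    a b i j : ℕ
    a = rotationExponent e
    b = reflectionExponent e
    i = rotationExponent y
    j = reflectionExponent y
    rotations : (a + i * 2 ^ b) % 3 ≡ rotationExponent x
    rotations = proj₁ (dihedralShift-correct e x)
    reflections : (b + j) % 2 ≡ reflectionExponent x
    reflections = proj₂ (dihedralShift-correct e x)

  element∈G : ∀ e → element e ∈ₗ G
  element∈G e = closed (^ₚ-∈ r∈G (rotationExponent e)) (^ₚ-∈ s∈G (reflectionExponent e))

  open RegularLabelling G-subgroup q element element∈G element-onto dihedralShift element-table public

-- Orbit representatives

subsetOf : List ℕ → Subset 6
subsetOf xs = tabulate λ y → any (toℕ y ≡ᵇ_) xs

⟨_∣_⟩ : List ℕ → List ℕ → Tuple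
⟨ A ∣ B ⟩ = subsetOf A ∷ subsetOf B ∷ ∅ ∷ ∅ ∷ ∅ ∷ ∅ ∷ []

⟨_∣_∣_⟩ : List ℕ → List ℕ → List ℕ → Tuple
⟨ A ∣ B ∣ C ⟩ = subsetOf A ∷ subsetOf B ∷ subsetOf C ∷ ∅ ∷ ∅ ∷ ∅ ∷ []

cyclic42 : Fin 3 → Tuple
cyclic42 = lookup
  ( ⟨ 0 ∷ 1 ∷ 2 ∷ 3 ∷ [] ∣ 4 ∷ 5 ∷ [] ⟩
  ∷ ⟨ 0 ∷ 1 ∷ 2 ∷ 4 ∷ [] ∣ 3 ∷ 5 ∷ [] ⟩
  ∷ ⟨ 0 ∷ 1 ∷ 3 ∷ 4 ∷ [] ∣ 2 ∷ 5 ∷ [] ⟩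
  ∷ [])

cyclic42-classified : ∀ C → IsTabloid λ42 C → ModelOrbit cyclicShift cyclic42 C
cyclic42-classified = from-yes (allTabloids? (modelOrbit? cyclicShift cyclic42) λ42)

cyclic411 : Fin 5 → Tuple
cyclic411 = lookup
  ( ⟨ 0 ∷ 1 ∷ 2 ∷ 3 ∷ [] ∣ 4 ∷ [] ∣ 5 ∷ [] ⟩
  ∷ ⟨ 0 ∷ 1 ∷ 2 ∷ 3 ∷ [] ∣ 5 ∷ [] ∣ 4 ∷ [] ⟩
  ∷ ⟨ 0 ∷ 1 ∷ 2 ∷ 4 ∷ [] ∣ 3 ∷ [] ∣ 5 ∷ [] ⟩
  ∷ ⟨ 0 ∷ 1 ∷ 2 ∷ 4 ∷ [] ∣ 5 ∷ [] ∣ 3 ∷ [] ⟩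
  ∷ ⟨ 0 ∷ 1 ∷ 3 ∷ 4 ∷ [] ∣ 2 ∷ [] ∣ 5 ∷ [] ⟩
  ∷ [])

cyclic411-classified : ∀ C → IsTabloid λ411 C → ModelOrbit cyclicShift cyclic411 C
cyclic411-classified = from-yes (allTabloids? (modelOrbit? cyclicShift cyclic411) λ411)

cyclic33 : Fin 4 → Tuple
cyclic33 = lookup
  ( ⟨ 0 ∷ 1 ∷ 2 ∷ [] ∣ 3 ∷ 4 ∷ 5 ∷ [] ⟩
  ∷ ⟨ 0 ∷ 1 ∷ 3 ∷ [] ∣ 2 ∷ 4 ∷ 5 ∷ [] ⟩
  ∷ ⟨ 0 ∷ 1 ∷ 4 ∷ [] ∣ 2 ∷ 3 ∷ 5 ∷ [] ⟩
  ∷ ⟨ 0 ∷ 2 ∷ 4 ∷ [] ∣ 1 ∷ 3 ∷ 5 ∷ [] ⟩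
  ∷ [])

cyclic33-classified : ∀ C → IsTabloid λ33 C → ModelOrbit cyclicShift cyclic33 C
cyclic33-classified = from-yes (allTabloids? (modelOrbit? cyclicShift cyclic33) λ33)

dihedral42 : Fin 4 → Tuple
dihedral42 = lookup
  ( ⟨ 0 ∷ 1 ∷ 2 ∷ 3 ∷ [] ∣ 4 ∷ 5 ∷ [] ⟩
  ∷ ⟨ 0 ∷ 1 ∷ 3 ∷ 4 ∷ [] ∣ 2 ∷ 5 ∷ [] ⟩
  ∷ ⟨ 0 ∷ 1 ∷ 3 ∷ 5 ∷ [] ∣ 2 ∷ 4 ∷ [] ⟩
  ∷ ⟨ 0 ∷ 1 ∷ 4 ∷ 5 ∷ [] ∣ 2 ∷ 3 ∷ [] ⟩
  ∷ [])

dihedral42-classified : ∀ C → IsTabloid λ42 C → ModelOrbit dihedralShift dihedral42 C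
dihedral42-classified = from-yes (allTabloids? (modelOrbit? dihedralShift dihedral42) λ42)

dihedral411 : Fin 5 → Tuple
dihedral411 = lookup
  ( ⟨ 0 ∷ 1 ∷ 2 ∷ 3 ∷ [] ∣ 4 ∷ [] ∣ 5 ∷ [] ⟩
  ∷ ⟨ 0 ∷ 1 ∷ 2 ∷ 3 ∷ [] ∣ 5 ∷ [] ∣ 4 ∷ [] ⟩
  ∷ ⟨ 0 ∷ 1 ∷ 3 ∷ 4 ∷ [] ∣ 2 ∷ [] ∣ 5 ∷ [] ⟩
  ∷ ⟨ 0 ∷ 1 ∷ 3 ∷ 5 ∷ [] ∣ 2 ∷ [] ∣ 4 ∷ [] ⟩
  ∷ ⟨ 0 ∷ 1 ∷ 4 ∷ 5 ∷ [] ∣ 2 ∷ [] ∣ 3 ∷ [] ⟩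
  ∷ [])

dihedral411-classified : ∀ C → IsTabloid λ411 C → ModelOrbit dihedralShift dihedral411 C
dihedral411-classified = from-yes (allTabloids? (modelOrbit? dihedralShift dihedral411) λ411)

dihedral33 : Fin 4 → Tuple
dihedral33 = lookup
  ( ⟨ 0 ∷ 1 ∷ 2 ∷ [] ∣ 3 ∷ 4 ∷ 5 ∷ [] ⟩
  ∷ ⟨ 0 ∷ 1 ∷ 3 ∷ [] ∣ 2 ∷ 4 ∷ 5 ∷ [] ⟩
  ∷ ⟨ 0 ∷ 1 ∷ 4 ∷ [] ∣ 2 ∷ 3 ∷ 5 ∷ [] ⟩
  ∷ ⟨ 0 ∷ 1 ∷ 5 ∷ [] ∣ 2 ∷ 3 ∷ 4 ∷ [] ⟩
  ∷ [])

dihedral33-classified : ∀ C → IsTabloid λ33 C → ModelOrbit dihedralShift dihedral33 C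
dihedral33-classified = from-yes (allTabloids? (modelOrbit? dihedralShift dihedral33) λ33)

3≤n≤4⇒n≡3⊎n≡4 : ∀ {n} → 3 ≤ n → n ≤ 4 → n ≡ 3 ⊎ n ≡ 4
3≤n≤4⇒n≡3⊎n≡4 {3} _ _ = inj₁ refl
3≤n≤4⇒n≡3⊎n≡4 {4} _ _ = inj₂ refl
3≤n≤4⇒n≡3⊎n≡4 {suc (suc (suc (suc (suc _))))} _ (s≤s (s≤s (s≤s (s≤s ()))))
3≤n≤4⇒n≡3⊎n≡4 {0} ()
3≤n≤4⇒n≡3⊎n≡4 {1} (s≤s ())
3≤n≤4⇒n≡3⊎n≡4 {2} (s≤s (s≤s ()))

corollary2p8 : (G : List Perm) → IsSubgroup G → order G ≡ 6 →
    (a b c : ℕ) →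
    OrbitCount G λ51 1 → OrbitCount G λ42 a → 3 ≤ a →
    OrbitCount G λ411 b → OrbitCount G λ33 c →
    (IsCyclic G → a ≡ 3 × b ≤ 5 × c ≤ 4) ×
    (IsDihedral G → (a ≡ 3 ⊎ a ≡ 4) × b ≤ 5 × c ≤ 4)
corollary2p8 G G-subgroup _ a b c n51 n42 3≤a n411 n33 = cyclic , dihedral
  where
  open Subgroup G-subgroup using (orbitCount51⇒transitive)

  transitive : IsTransitiveAt G (proj₁ (orbitCount51⇒transitive n51))
  transitive = proj₂ (orbitCount51⇒transitive n51)

  cyclic : IsCyclic G → a ≡ 3 × b ≤ 5 × c ≤ 4
  cyclic (g , g∈G , generates) =
    ≤-antisym (orbitCount≤model λ42 cyclic42 cyclic42-classified n42) 3≤a ,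
    orbitCount≤model λ411 cyclic411 cyclic411-classified n411 ,
    orbitCount≤model λ33 cyclic33 cyclic33-classified n33
    where open Cyclic G-subgroup g∈G generates transitive

  dihedral : IsDihedral G → (a ≡ 3 ⊎ a ≡ 4) × b ≤ 5 × c ≤ 4
  dihedral (r , s , r∈G , s∈G , r³≡id , s²≡id , srs≡r² , words) =
    3≤n≤4⇒n≡3⊎n≡4 3≤a (orbitCount≤model λ42 dihedral42 dihedral42-classified n42) ,
    orbitCount≤model λ411 dihedral411 dihedral411-classified n411 ,
    orbitCount≤model λ33 dihedral33 dihedral33-classified n33
    where open Dihedral G-subgroup r∈G s∈G r³≡id s²≡id srs≡r² words transitive
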